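{- For every even integer $n\ge 4$, $g^3(C_n)\le \frac{n}{2}+3$.
   Context: $C_n$ denotes the cyclic group of order $n$. For a finite abelian group $G$ (written additively) and a positive integer $k$, the $k$-Harborth constant $g^k(G)$ is the smallest positive integer $t$ such that every subset $S\subseteq G$ with $|S|\ge t$ contains a subset $T$ with $|T|=k$ and $\sum_{x\in T}x=0$. -}

module Defs where

open import Data.Nat using (ℕ; zero; suc; _+_; _≤_; _<_; NonZero)
open import Data.Nat.DivMod using (_%_)
open import Data.Fin using (Fin; toℕ)
open import Data.Fin.Subset using (Subset; _∈_; _⊆_; ∣_∣; inside)
open import Data.Vec using (Vec; lookup; allFin; toList)
open import Data.List using (List; foldr)
open import Data.Bool using (Bool; true; false; if_then_else_)
open import Data.Product using (Σ; _×_; ∃-syntax)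
open import Relation.Binary.PropositionalEquality using (_≡_)

-- The cyclic group C_n is modelled as ℤ/nℤ with carrier Fin n
-- (element i ∈ Fin n represents the residue toℕ i).
-- The sum of a subset T ⊆ C_n, computed as a natural number
-- (sum of representatives); it is zero in C_n iff it is ≡ 0 mod n.
subsetSumℕ : ∀ {n} → Subset n → ℕ
subsetSumℕ {n} T =
  foldr (λ i acc → (if lookup T i then toℕ i else 0) + acc) 0 (toList (allFin n))

ZeroSum : ∀ {n} → .{{NonZero n}} → Subset n → Set
ZeroSum {n} T = subsetSumℕ T % n ≡ 0

HarborthProperty : (k n : ℕ) → .{{NonZero n}} → ℕ → Set
HarborthProperty k n t =
  (S : Subset n) → t ≤ ∣ S ∣ → ∃[ T ] (T ⊆ S × ∣ T ∣ ≡ k × ZeroSum T)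

IsHarborthConstant : (k n : ℕ) → .{{NonZero n}} → ℕ → Set
IsHarborthConstant k n g =
  0 < g × HarborthProperty k n g ×
  ((t : ℕ) → 0 < t → HarborthProperty k n t → g ≤ t)

module Submission where

-- Fix z ∈ S and let σ x = −z − x in ℤ/nℤ: an involution with x + σ x + z ≡ 0
-- whose fixed points solve 2x ≡ −z, so there are at most two of them.
-- Unless some x with x, σ x ∈ S makes {x, σ x, z} a 3-set, every such x is a
-- fixed point, z or σ z; counting S and σ⁻¹ S then gives 2|S| ≤ n + 4.
-- So |S| ≥ n/2 + 3 forces a zero-sum 3-subset, and as the Harborth property
-- is decidable, a least such bound exists.

open import Level using (Level)
open import Algebra.Definitions using (Involutive)
open import Data.Bool using (if_then_else_)
open import Data.Empty using (⊥)
open import Data.Fin using (Fin; zero; suc; toℕ; fromℕ<)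
import Data.Fin.Properties as Finₚ
open Finₚ using (any?; _≟_; toℕ<n; toℕ-fromℕ<; toℕ-injective)
open import Data.Fin.Permutation using (permutation)
open import Data.Fin.Subset using (Subset; inside; outside; _∈_; _⊆_; ⁅_⁆; _∪_; ∣_∣)
open import Data.Fin.Subset.Properties
  using (_∈?_; _⊆?_; anySubset?; nonempty?; Empty-unique; ∣⊥∣≡0; ∪⇔⊎; x∈⁅y⁆⇔x≡y)
open import Data.List using (foldr)
open import Data.Nat
  using (ℕ; zero; suc; _+_; _*_; _∸_; _%_; _≤_; _<_; _≤?_; z≤n; s≤s; s≤s⁻¹; NonZero)
import Data.Nat as ℕ
open import Data.Nat.Divisibility using (_∣_; _∣0; ∣-refl; ∣-reflexive; ∣m∣n⇒∣m+n; n∣m⇒m%n≡0)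
open import Data.Nat.Properties
  using (+-0-commutativeMonoid; +-assoc; +-comm; +-identityʳ; +-mono-≤;
        +-mono-≤-<; +-monoʳ-≤; *-cancelˡ-≡; ∸-monoʳ-<; <-irrefl; <-≤-trans;
        <⇒≤; <⇒≱; ≤-<-trans; ≤-refl; ≤-reflexive; ≤-trans; ≮⇒≥; ≰⇒>; m∸n≤m;
        m+n∸m≡n; m+n∸n≡m; m+[n∸m]≡n; m<m+n; m≤m+n; m≤n+m; anyUpTo?;
        module ≤-Reasoning)
open import Data.Nat.Solver using (module +-*-Solver)
open +-*-Solver using (solve; _:+_; _:*_; con; _:=_)
open import Data.Product using (_×_; _,_; ∃-syntax)
open import Data.Sum as Sum using (_⊎_; inj₁; inj₂)
open import Data.Sum.Function.Propositional using (_⊎-⇔_)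
open import Data.Vec using ([]; _∷_; lookup; tabulate; toList)
open import Data.Vec.Functional using (Vector)
open import Function using (_∘_; id; _⇔_; Equivalence)
open import Function.Properties.Equivalence using () renaming (trans to ⇔-trans)
open import Relation.Binary.PropositionalEquality
open import Relation.Nullary using (Dec; ¬_; yes; no; does; contradiction; ¬?; _×-dec_; _→-dec_)
open import Relation.Nullary.Decidable using (does-⇔; decidable-stable)
open import Relation.Unary as U using (Pred; Decidable)
open import Relation.Unary.Properties using (_∪?_)
open import Algebra.Properties.CommutativeMonoid.Sum +-0-commutativeMonoid
  using (sum; sum-cong-≗; sum-replicate-zero; ∑-distrib-+; sum-permute)

open import Defs

private variable
  n : ℕ
  ℓ ℓ′ : Level

∑-mono-≤ : {f g : Vector ℕ n} → (∀ i → f i ≤ g i) → sum f ≤ sum g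
∑-mono-≤ {zero}  f≤g = z≤n
∑-mono-≤ {suc n} f≤g = +-mono-≤ (f≤g zero) (∑-mono-≤ (f≤g ∘ suc))

∑-ones : ∀ n → sum {n} (λ _ → 1) ≡ n
∑-ones zero    = refl
∑-ones (suc n) = cong suc (∑-ones n)

restrict : {P : Pred (Fin n) ℓ} → Decidable P → Vector ℕ n → Vector ℕ n
restrict P? g i = if does (P? i) then g i else 0

sumWhere : {P : Pred (Fin n) ℓ} → Decidable P → Vector ℕ n → ℕ
sumWhere P? g = sum (restrict P? g)

indicator : {P : Pred (Fin n) ℓ} → Decidable P → Vector ℕ n
indicator P? = restrict P? (λ _ → 1)

count : {P : Pred (Fin n) ℓ} → Decidable P → ℕ
count P? = sum (indicator P?)

module _ {P : Pred (Fin n) ℓ} {Q : Pred (Fin n) ℓ′} (P? : Decidable P) (Q? : Decidable Q) where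

  sumWhere-cong : (∀ i → P i ⇔ Q i) → (g : Vector ℕ n) → sumWhere P? g ≡ sumWhere Q? g
  sumWhere-cong P⇔Q g = sum-cong-≗ λ i → cong (if_then g i else 0) (does-⇔ (P⇔Q i) (P? i) (Q? i))

  sumWhere-∪ : P U.⊥ Q → (g : Vector ℕ n) → sumWhere (P? ∪? Q?) g ≡ sumWhere P? g + sumWhere Q? g
  sumWhere-∪ P⊥Q g = trans (sum-cong-≗ split) (∑-distrib-+ (restrict P? g) (restrict Q? g))
    where
    split : ∀ i → restrict (P? ∪? Q?) g i ≡ restrict P? g i + restrict Q? g i
    split i with P? i | Q? i
    ... | yes p | yes q = contradiction (p , q) P⊥Q
    ... | yes _ | no _  = sym (+-identityʳ (g i))
    ... | no _  | yes _ = refl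
    ... | no _  | no _  = refl

  count-mono : P U.⊆ Q → count P? ≤ count Q?
  count-mono P⊆Q = ∑-mono-≤ pointwise
    where
    pointwise : ∀ i → indicator P? i ≤ indicator Q? i
    pointwise i with P? i | Q? i
    ... | yes p | no ¬q = contradiction (P⊆Q p) ¬q
    ... | yes _ | yes _ = ≤-refl
    ... | no _  | _     = z≤n

  count-∪ : count (P? ∪? Q?) ≤ count P? + count Q?
  count-∪ = ≤-trans (∑-mono-≤ pointwise) (≤-reflexive (∑-distrib-+ (indicator P?) (indicator Q?)))
    where
    pointwise : ∀ i → indicator (P? ∪? Q?) i ≤ indicator P? i + indicator Q? i
    pointwise i with P? i | Q? i
    ... | yes _ | yes _ = s≤s z≤n
    ... | yes _ | no _  = ≤-refl
    ... | no _  | yes _ = ≤-refl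
    ... | no _  | no _  = z≤n

sumWhere-≡ : (x : Fin n) (g : Vector ℕ n) → sumWhere (_≟ x) g ≡ g x
sumWhere-≡ {suc n} zero g = trans (cong (g zero +_) (sum-replicate-zero n)) (+-identityʳ (g zero))
sumWhere-≡ {suc n} (suc x) g = sumWhere-≡ x (g ∘ suc)

count-∅ : {P : Pred (Fin n) ℓ} (P? : Decidable P) → (∀ i → ¬ P i) → count P? ≡ 0
count-∅ {n} P? ∄P = trans (sum-cong-≗ absent) (sum-replicate-zero n)
  where
  absent : ∀ i → indicator P? i ≡ 0
  absent i with P? i
  ... | yes p = contradiction p (∄P i)
  ... | no _  = refl

count≤1 : {P : Pred (Fin n) ℓ} (P? : Decidable P) → (∀ {i j} → P i → P j → i ≡ j) → count P? ≤ 1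
count≤1 {zero}  P? unique = z≤n
count≤1 {suc n} P? unique with P? zero
... | yes p₀ = ≤-reflexive (cong suc (count-∅ (P? ∘ suc) (λ i p → Finₚ.0≢1+n (unique p₀ p))))
... | no _   = count≤1 (P? ∘ suc) (λ p q → Finₚ.suc-injective (unique p q))

module _ (f : Fin n → Fin n) (f-involutive : Involutive _≡_ f)
         {P : Pred (Fin n) ℓ} {E : Pred (Fin n) ℓ′} (P? : Decidable P) (E? : Decidable E) where

  count-∘-involution : count (P? ∘ f) ≡ count P?
  count-∘-involution = sym (sum-permute (indicator P?) (permutation f f f-involutive f-involutive))

  count-pairing : (∀ {i} → P i → P (f i) → E i) → count P? + count P? ≤ n + count E?
  count-pairing P-closed = begin
    count P? + count P?                    ≡⟨ cong (count P? +_) count-∘-involution ⟨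
    count P? + count (P? ∘ f)              ≡⟨ ∑-distrib-+ (indicator P?) (indicator (P? ∘ f)) ⟨
    sum (λ i → indicator P? i + indicator P? (f i)) ≤⟨ ∑-mono-≤ pointwise ⟩
    sum (λ i → 1 + indicator E? i)         ≡⟨ ∑-distrib-+ (λ _ → 1) (indicator E?) ⟩
    sum {n} (λ _ → 1) + count E?           ≡⟨ cong (_+ count E?) (∑-ones n) ⟩
    n + count E?                           ∎
    where
    open ≤-Reasoning
    pointwise : ∀ i → indicator P? i + indicator P? (f i) ≤ 1 + indicator E? i
    pointwise i with P? i | P? (f i) | E? i
    ... | yes p | yes pf | no ¬e = contradiction (P-closed p pf) ¬e
    ... | yes _ | yes _  | yes _ = ≤-refl
    ... | yes _ | no _   | _     = s≤s z≤n
    ... | no _  | yes _  | _     = s≤s z≤n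
    ... | no _  | no _   | _     = z≤n

  ∃-pair-outside : n + count E? < count P? + count P? → ∃[ i ] (P i × P (f i) × ¬ E i)
  ∃-pair-outside large with any? (λ i → P? i ×-dec P? (f i) ×-dec ¬? (E? i))
  ... | yes pair = pair
  ... | no ∄pair = contradiction (count-pairing P-closed) (<⇒≱ large)
    where
    P-closed : ∀ {i} → P i → P (f i) → E i
    P-closed {i} p pf = decidable-stable (E? i) (λ ¬e → ∄pair (i , p , pf , ¬e))

does-∈? : (p : Subset n) (i : Fin n) → does (i ∈? p) ≡ lookup p i
does-∈? (inside  ∷ p) zero    = refl
does-∈? (outside ∷ p) zero    = refl
does-∈? (_       ∷ p) (suc i) = does-∈? p i

∣p∣≡count : (p : Subset n) → ∣ p ∣ ≡ count (_∈? p)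
∣p∣≡count []            = refl
∣p∣≡count (inside  ∷ p) = cong suc (∣p∣≡count p)
∣p∣≡count (outside ∷ p) = ∣p∣≡count p

foldr-tabulate : ∀ {m} (k : Fin m → Fin n) (h : Vector ℕ n) →
                 foldr (λ i acc → h i + acc) 0 (toList (tabulate k)) ≡ sum (h ∘ k)
foldr-tabulate {m = zero}  k h = refl
foldr-tabulate {m = suc m} k h = cong (h (k zero) +_) (foldr-tabulate (k ∘ suc) h)

subsetSumℕ≡sumWhere : (p : Subset n) → subsetSumℕ p ≡ sumWhere (_∈? p) toℕ
subsetSumℕ≡sumWhere p = trans (foldr-tabulate id (λ i → if lookup p i then toℕ i else 0))
  (sum-cong-≗ λ i → cong (if_then toℕ i else 0) (sym (does-∈? p i)))

triple : Fin n → Fin n → Fin n → Subset n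
triple x y z = ⁅ x ⁆ ∪ ⁅ y ⁆ ∪ ⁅ z ⁆

∈triple⇔ : ∀ {x y z i : Fin n} → i ∈ triple x y z ⇔ (i ≡ x ⊎ i ≡ y ⊎ i ≡ z)
∈triple⇔ = ⇔-trans ∪⇔⊎ (x∈⁅y⁆⇔x≡y ⊎-⇔ ⇔-trans ∪⇔⊎ (x∈⁅y⁆⇔x≡y ⊎-⇔ x∈⁅y⁆⇔x≡y))

triple⊆ : {x y z : Fin n} {p : Subset n} → x ∈ p → y ∈ p → z ∈ p → triple x y z ⊆ p
triple⊆ x∈p y∈p z∈p i∈xyz with Equivalence.to ∈triple⇔ i∈xyz
... | inj₁ refl        = x∈p
... | inj₂ (inj₁ refl) = y∈p
... | inj₂ (inj₂ refl) = z∈p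

module _ {n} {x y z : Fin n} (x≢y : x ≢ y) (x≢z : x ≢ z) (y≢z : y ≢ z) where

  sumWhere-triple : (g : Vector ℕ n) → sumWhere (_∈? triple x y z) g ≡ g x + (g y + g z)
  sumWhere-triple g = begin
    sumWhere (_∈? triple x y z) g
      ≡⟨ sumWhere-cong (_∈? triple x y z) one-of? (λ _ → ∈triple⇔) g ⟩
    sumWhere one-of? g
      ≡⟨ sumWhere-∪ (_≟ x) ((_≟ y) ∪? (_≟ z)) x-apart g ⟩
    sumWhere (_≟ x) g + sumWhere ((_≟ y) ∪? (_≟ z)) g
      ≡⟨ cong₂ _+_ (sumWhere-≡ x g) (sumWhere-∪ (_≟ y) (_≟ z) y-apart g) ⟩
    g x + (sumWhere (_≟ y) g + sumWhere (_≟ z) g)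
      ≡⟨ cong (g x +_) (cong₂ _+_ (sumWhere-≡ y g) (sumWhere-≡ z g)) ⟩
    g x + (g y + g z)
      ∎
    where
    open ≡-Reasoning
    one-of? = (_≟ x) ∪? ((_≟ y) ∪? (_≟ z))
    x-apart : ∀ {i} → i ≡ x × (i ≡ y ⊎ i ≡ z) → ⊥
    x-apart (refl , inj₁ refl) = x≢y refl
    x-apart (refl , inj₂ refl) = x≢z refl
    y-apart : ∀ {i} → i ≡ y × i ≡ z → ⊥
    y-apart (refl , refl) = y≢z refl

  ∣triple∣≡3 : ∣ triple x y z ∣ ≡ 3
  ∣triple∣≡3 = trans (∣p∣≡count (triple x y z)) (sumWhere-triple (λ _ → 1))

  subsetSumℕ-triple : subsetSumℕ (triple x y z) ≡ toℕ x + toℕ y + toℕ z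
  subsetSumℕ-triple = begin
    subsetSumℕ (triple x y z)          ≡⟨ subsetSumℕ≡sumWhere (triple x y z) ⟩
    sumWhere (_∈? triple x y z) toℕ    ≡⟨ sumWhere-triple toℕ ⟩
    toℕ x + (toℕ y + toℕ z)            ≡⟨ +-assoc (toℕ x) (toℕ y) (toℕ z) ⟨
    toℕ x + toℕ y + toℕ z              ∎
    where open ≡-Reasoning

reflect : ℕ → ℕ → ℕ → ℕ
reflect n c x with x ≤? c
... | yes _ = c ∸ x
... | no _  = n + c ∸ x

reflect-< : ∀ {n c x} → c < n → x < n → reflect n c x < n
reflect-< {n} {c} {x} c<n x<n with x ≤? c
... | yes _   = ≤-<-trans (m∸n≤m c x) c<n
... | no x≰c  = subst (n + c ∸ x <_) (m+n∸n≡m n c)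
                  (∸-monoʳ-< (≰⇒> x≰c) (≤-trans (<⇒≤ x<n) (m≤m+n n c)))

reflect-+ : ∀ {n c x} → x < n → x + reflect n c x ≡ c ⊎ x + reflect n c x ≡ n + c
reflect-+ {n} {c} {x} x<n with x ≤? c
... | yes x≤c = inj₁ (m+[n∸m]≡n x≤c)
... | no _    = inj₂ (m+[n∸m]≡n (≤-trans (<⇒≤ x<n) (m≤m+n n c)))

reflect-unique : ∀ {n c x y} → y < n → x + y ≡ c ⊎ x + y ≡ n + c → reflect n c x ≡ y
reflect-unique {n} {c} {x} {y} y<n x+y with x ≤? c | x+y
... | yes _   | inj₁ e = trans (cong (_∸ x) (sym e)) (m+n∸m≡n x y)
... | yes x≤c | inj₂ e = contradiction (subst (_< c + n) e (+-mono-≤-< x≤c y<n)) (<-irrefl (+-comm n c))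
... | no x≰c  | inj₁ e = contradiction (subst (x ≤_) e (m≤m+n x y)) x≰c
... | no _    | inj₂ e = trans (cong (_∸ x) (sym e)) (m+n∸m≡n x y)

reflect-involutive : ∀ {n c x} → x < n → reflect n c (reflect n c x) ≡ x
reflect-involutive {x = x} x<n =
  reflect-unique x<n (Sum.map (trans (+-comm _ x)) (trans (+-comm _ x)) (reflect-+ x<n))

n∣s+reflect0 : ∀ {n s} → s < n → n ∣ s + reflect n 0 s
n∣s+reflect0 {n} s<n with reflect-+ {c = 0} s<n
... | inj₁ e = subst (n ∣_) (sym e) (n ∣0)
... | inj₂ e = subst (n ∣_) (sym e) (∣-reflexive (sym (+-identityʳ n)))

n∣x+reflect+s : ∀ {n c s x} → x < n → n ∣ s + c → n ∣ x + reflect n c x + s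
n∣x+reflect+s {n} {c} {s} {x} x<n n∣s+c with reflect-+ {c = c} x<n
... | inj₁ e = subst (n ∣_) (sym (trans (cong (_+ s) e) (+-comm c s))) n∣s+c
... | inj₂ e = subst (n ∣_) (sym (begin
    x + reflect n c x + s  ≡⟨ cong (_+ s) e ⟩
    n + c + s              ≡⟨ +-assoc n c s ⟩
    n + (c + s)            ≡⟨ cong (n +_) (+-comm c s) ⟩
    n + (s + c)            ∎)) (∣m∣n⇒∣m+n ∣-refl n∣s+c)
  where open ≡-Reasoning

twice-injective : ∀ {a b} → a + a ≡ b + b → a ≡ b
twice-injective {a} {b} e = *-cancelˡ-≡ a b 2 (begin
  2 * a   ≡⟨ cong (a +_) (+-identityʳ a) ⟩
  a + a   ≡⟨ e ⟩
  b + b   ≡⟨ cong (b +_) (+-identityʳ b) ⟨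
  2 * b   ∎)
  where open ≡-Reasoning

module Reflection {n : ℕ} (z : Fin n) where

  c : ℕ
  c = reflect n 0 (toℕ z)

  c<n : c < n
  c<n = reflect-< (≤-<-trans z≤n (toℕ<n z)) (toℕ<n z)

  σ : Fin n → Fin n
  σ x = fromℕ< (reflect-< c<n (toℕ<n x))

  toℕ-σ : ∀ x → toℕ (σ x) ≡ reflect n c (toℕ x)
  toℕ-σ x = toℕ-fromℕ< _

  σ-involutive : Involutive _≡_ σ
  σ-involutive x = toℕ-injective (begin
    toℕ (σ (σ x))                     ≡⟨ toℕ-σ (σ x) ⟩
    reflect n c (toℕ (σ x))           ≡⟨ cong (reflect n c) (toℕ-σ x) ⟩
    reflect n c (reflect n c (toℕ x)) ≡⟨ reflect-involutive (toℕ<n x) ⟩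
    toℕ x                             ∎)
    where open ≡-Reasoning

  n∣x+σx+z : ∀ x → n ∣ toℕ x + toℕ (σ x) + toℕ z
  n∣x+σx+z x rewrite toℕ-σ x = n∣x+reflect+s (toℕ<n x) (n∣s+reflect0 (toℕ<n z))

  Twice : ℕ → Fin n → Set
  Twice t x = toℕ x + toℕ x ≡ t

  twice? : ∀ t → Decidable (Twice t)
  twice? t x = toℕ x + toℕ x ℕ.≟ t

  fixed⇒twice : ∀ {x} → σ x ≡ x → Twice c x ⊎ Twice (n + c) x
  fixed⇒twice {x} σx≡x =
    subst (λ y → toℕ x + y ≡ c ⊎ toℕ x + y ≡ n + c)
          (trans (sym (toℕ-σ x)) (cong toℕ σx≡x)) (reflect-+ (toℕ<n x))

  count-fixed≤2 : count (λ x → σ x ≟ x) ≤ 2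
  count-fixed≤2 = begin
    count (λ x → σ x ≟ x)
      ≤⟨ count-mono (λ x → σ x ≟ x) (twice? c ∪? twice? (n + c)) fixed⇒twice ⟩
    count (twice? c ∪? twice? (n + c))
      ≤⟨ count-∪ (twice? c) (twice? (n + c)) ⟩
    count (twice? c) + count (twice? (n + c))
      ≤⟨ +-mono-≤ (count≤1 (twice? c) unique) (count≤1 (twice? (n + c)) unique) ⟩
    2 ∎
    where
    open ≤-Reasoning
    unique : ∀ {t i j} → Twice t i → Twice t j → i ≡ j
    unique ti tj = toℕ-injective (twice-injective (trans ti (sym tj)))

  -- x is exceptional iff x, σ x and z are not pairwise distinct.
  Exceptional : Fin n → Set
  Exceptional x = σ x ≡ x ⊎ x ≡ z ⊎ x ≡ σ z

  exceptional? : Decidable Exceptional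
  exceptional? = (λ x → σ x ≟ x) ∪? (_≟ z) ∪? (_≟ σ z)

  count-exceptional≤4 : count exceptional? ≤ 4
  count-exceptional≤4 = begin
    count exceptional?
      ≤⟨ count-∪ (λ x → σ x ≟ x) ((_≟ z) ∪? (_≟ σ z)) ⟩
    count (λ x → σ x ≟ x) + count ((_≟ z) ∪? (_≟ σ z))
      ≤⟨ +-mono-≤ count-fixed≤2 (count-∪ (_≟ z) (_≟ σ z)) ⟩
    2 + (count (_≟ z) + count (_≟ σ z))
      ≤⟨ +-monoʳ-≤ 2 (+-mono-≤ (count≤1 (_≟ z) ≡-unique) (count≤1 (_≟ σ z) ≡-unique)) ⟩
    4 ∎
    where
    open ≤-Reasoning
    ≡-unique : ∀ {i j w : Fin n} → i ≡ w → j ≡ w → i ≡ j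
    ≡-unique p q = trans p (sym q)

  σx≢z : ∀ {x} → ¬ Exceptional x → σ x ≢ z
  σx≢z {x} regular σx≡z = regular (inj₂ (inj₂ (trans (sym (σ-involutive x)) (cong σ σx≡z))))

zeroSumTriple-through : ∀ {n} .{{_ : NonZero n}} {S : Subset n} {z : Fin n} → z ∈ S →
                        n + 4 < ∣ S ∣ + ∣ S ∣ → ∃[ T ] (T ⊆ S × ∣ T ∣ ≡ 3 × ZeroSum T)
zeroSumTriple-through {n} {S} {z} z∈S large =
  let x , x∈S , σx∈S , regular = ∃-pair-outside σ σ-involutive (_∈? S) exceptional? few-exceptional
      x≢σx = regular ∘ inj₁ ∘ sym
      x≢z = regular ∘ inj₂ ∘ inj₁
  in triple x (σ x) z , triple⊆ x∈S σx∈S z∈S , ∣triple∣≡3 x≢σx x≢z (σx≢z regular) ,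
     n∣m⇒m%n≡0 _ n (subst (n ∣_) (sym (subsetSumℕ-triple x≢σx x≢z (σx≢z regular))) (n∣x+σx+z x))
  where
  open Reflection z
  few-exceptional : n + count exceptional? < count (_∈? S) + count (_∈? S)
  few-exceptional = begin-strict
    n + count exceptional?            ≤⟨ +-monoʳ-≤ n count-exceptional≤4 ⟩
    n + 4                             <⟨ large ⟩
    ∣ S ∣ + ∣ S ∣                     ≡⟨ cong₂ _+_ (∣p∣≡count S) (∣p∣≡count S) ⟩
    count (_∈? S) + count (_∈? S)     ∎
    where open ≤-Reasoning

zeroSumTriple : ∀ {n} .{{_ : NonZero n}} (S : Subset n) → n + 4 < ∣ S ∣ + ∣ S ∣ →
                ∃[ T ] (T ⊆ S × ∣ T ∣ ≡ 3 × ZeroSum T)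
zeroSumTriple {n} S large with nonempty? S
... | yes (z , z∈S) = zeroSumTriple-through z∈S large
... | no S-empty   = contradiction (subst (λ k → n + 4 < k + k) ∣S∣≡0 large) λ ()
  where
  ∣S∣≡0 : ∣ S ∣ ≡ 0
  ∣S∣≡0 = trans (cong ∣_∣ (Empty-unique S-empty)) (∣⊥∣≡0 n)

harborthProperty : ∀ {n} .{{_ : NonZero n}} t → n + 4 < t + t → HarborthProperty 3 n t
harborthProperty t large S t≤∣S∣ = zeroSumTriple S (<-≤-trans large (+-mono-≤ t≤∣S∣ t≤∣S∣))

allSubsets? : ∀ {n} {P : Pred (Subset n) ℓ} → Decidable P → Dec (∀ p → P p)
allSubsets? P? with anySubset? (¬? ∘ P?)
... | yes (p , ¬Pp) = no (λ ∀P → ¬Pp (∀P p))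
... | no ∄¬P        = yes (λ p → decidable-stable (P? p) (λ ¬Pp → ∄¬P (p , ¬Pp)))

harborthProperty? : ∀ k n .{{_ : NonZero n}} t → Dec (HarborthProperty k n t)
harborthProperty? k n t = allSubsets? λ S → (t ≤? ∣ S ∣) →-dec anySubset? λ T →
  (T ⊆? S) ×-dec (∣ T ∣ ℕ.≟ k) ×-dec (subsetSumℕ T % n ℕ.≟ 0)

module _ {P : Pred ℕ ℓ} (P? : Decidable P) where

  least-below : ∀ b → ∃[ t ] (t < b × P t) → ∃[ g ] (P g × (∀ t → P t → g ≤ t))
  least-below (suc b) (t , t<1+b , Pt) with anyUpTo? P? b
  ... | yes below = least-below b below
  ... | no ∄below = t , Pt , λ u Pu → ≤-trans (s≤s⁻¹ t<1+b) (≮⇒≥ λ u<b → ∄below (u , u<b , Pu))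

  least : ∀ {m} → P m → ∃[ g ] (P g × (∀ t → P t → g ≤ t))
  least {m} Pm = least-below (suc m) (m , ≤-refl , Pm)

harborthConstant≤ : ∀ k n .{{_ : NonZero n}} t → 0 < t → HarborthProperty k n t →
                    ∃[ g ] (IsHarborthConstant k n g × g ≤ t)
harborthConstant≤ k n t 0<t t-harborth =
  let g , (0<g , g-harborth) , g-least = least valid? (0<t , t-harborth)
  in g , (0<g , g-harborth , λ u 0<u u-harborth → g-least u (0<u , u-harborth)) ,
     g-least t (0<t , t-harborth)
  where
  valid? : Decidable (λ u → 0 < u × HarborthProperty k n u)
  valid? u = (0 ℕ.<? u) ×-dec harborthProperty? k n u

proposition3p14 : (m : ℕ) → 2 ≤ m → .{{_ : NonZero (2 * m)}} →
    ∃[ g ] (IsHarborthConstant 3 (2 * m) g × g ≤ m + 3)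
proposition3p14 m _ =
  harborthConstant≤ 3 (2 * m) (m + 3) 0<m+3 (harborthProperty (m + 3) 2m+4<2[m+3])
  where
  0<m+3 : 0 < m + 3
  0<m+3 = <-≤-trans (s≤s z≤n) (m≤n+m 3 m)
  2[m+3]≡2m+4+2 : m + 3 + (m + 3) ≡ 2 * m + 4 + 2
  2[m+3]≡2m+4+2 =
    solve 1 (λ m → (m :+ con 3) :+ (m :+ con 3) := con 2 :* m :+ con 4 :+ con 2) refl m
  2m+4<2[m+3] : 2 * m + 4 < m + 3 + (m + 3)
  2m+4<2[m+3] = subst (2 * m + 4 <_) (sym 2[m+3]≡2m+4+2) (m<m+n _ {2} (s≤s z≤n))
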